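{- Let $A,B\subseteq\mathbb{Z}$ be finite nonempty sets with $|A|\ge 5$, $|B|\ge 2$, $B\subseteq A$, and $|A\widehat{+}B|=|A|+|B|-3$. Then $A=B$ and there exist $\tau,d\in\mathbb{Z}$ with $d\ne 0$ such that $A=\{\tau+id: i=0,1,\dots,|A|-1\}$.
   Context: For finite sets $A,B\subseteq\mathbb{Z}$, the restricted sumset is $A\widehat{+}B=\{a+b: a\in A,\ b\in B,\ a\neq b\}$. A pair with $|A\widehat{+}B|=|A|+|B|-3$ is a critical pair; $(A,B)$ is a standard pair if $A=B$ is an arithmetic progression $\{\tau+id\}$ with $d\neq 0$. -}

module Defs where

open import Data.Nat using (ℕ; _<_)
open import Data.Integer using (ℤ; _+_; _*_; +_)
open import Data.List using (List; length)
open import Data.List.Membership.Propositional using (_∈_)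
open import Data.List.Relation.Unary.Unique.Propositional using (Unique)
open import Data.Product using (_×_; ∃; ∃-syntax; Σ)
open import Relation.Binary.PropositionalEquality using (_≡_; _≢_)
open import Relation.Nullary using (¬_)
open import Function.Bundles using (_⇔_)

record FinSetℤ : Set where
  constructor mkFinSet
  field
    elems  : List ℤ
    unique : Unique elems

open FinSetℤ public

_∈ₛ_ : ℤ → FinSetℤ → Set
x ∈ₛ A = x ∈ elems A

∣_∣ₛ : FinSetℤ → ℕ
∣ A ∣ₛ = length (elems A)

_⊆ₛ_ : FinSetℤ → FinSetℤ → Set
A ⊆ₛ B = ∀ {x} → x ∈ₛ A → x ∈ₛ B

_≐ₛ_ : FinSetℤ → FinSetℤ → Set
A ≐ₛ B = ∀ x → (x ∈ₛ A) ⇔ (x ∈ₛ B)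

InRestrictedSum : FinSetℤ → FinSetℤ → ℤ → Set
InRestrictedSum A B x = ∃[ a ] ∃[ b ] (a ∈ₛ A × b ∈ₛ B × a ≢ b × x ≡ a + b)

IsRestrictedSumset : FinSetℤ → FinSetℤ → FinSetℤ → Set
IsRestrictedSumset A B S = ∀ x → (x ∈ₛ S) ⇔ InRestrictedSum A B x

IsAPWith : FinSetℤ → ℤ → ℤ → ℕ → Set
IsAPWith A τ d n = ∀ x → (x ∈ₛ A) ⇔ (∃[ i ] (i < n × x ≡ τ + (+ i) * d))

-- Enumerate A increasingly. Removing its minimum x and recording the one or two new restricted
-- sums that lie below all sums of the remaining elements (x + b for the least b ∈ B, or x + y and
-- x + z for the next two elements y < z) builds, by induction, a duplicate-free list of restricted
-- sums; counting it gives |A +̂ B| ≥ |A| + |B| − 2 whenever B ⊊ A, so a critical pair has A = B.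
-- For A = B the same construction yields the 2n − 3 sums a₁+a₂ < a₁+a₃ < a₂+a₃ < a₂+a₄ < ⋯, and
-- one sum more as soon as some four consecutive terms a < b < c < d have a + d ≠ b + c (for
-- n = 5 also when a + e ≠ b + d or b + e ≠ c + d); if no such inequality occurs, A is an
-- arithmetic progression.
module Submission where

open import Defs
open import Data.Nat.Base as ℕ using (ℕ; suc; s≤s; z≤n)
import Data.Nat.Properties as ℕₚ
open import Data.Integer.Base using (ℤ; +_; 0ℤ; _+_; _-_; _*_; _<_; _≤_)
import Data.Integer.Properties as ℤₚ
open ℤₚ using (_≟_; <⇒≢; <-trans)
open import Algebra.Properties.AbelianGroup ℤₚ.+-0-abelianGroup
  using (//-rightDividesˡ) renaming (∙-cancelˡ to +-cancelˡ; ∙-cancelʳ to +-cancelʳ)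
open import Algebra.Properties.CommutativeSemigroup ℤₚ.+-commutativeSemigroup
  using (x∙yz≈y∙xz; x∙yz≈yx∙z; x∙yz≈xz∙y; xy∙z≈x∙zy; xy∙z≈yz∙x)
open import Data.List.Base using (List; []; _∷_; [_]; length; map; filter; applyUpTo; deduplicate)
open import Data.List.Properties
  using (length-map; length-filter; length-deduplicate; filter-none; filter-all)
open import Data.List.Membership.Propositional using (_∈_; find; lose)
open import Data.List.Membership.Propositional.Properties
  using (∈-filter⁺; ∈-filter⁻; ∈-applyUpTo⁺; ∈-applyUpTo⁻; ∈-deduplicate⁺)
open import Data.List.Membership.Propositional.Properties.WithK using (unique∧set⇒bag)
open import Data.List.Membership.DecPropositional _≟_ using (_∈?_)
open import Data.List.Relation.Binary.BagAndSetEquality using (∼bag⇒↭)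
open import Data.List.Relation.Binary.Permutation.Propositional using (↭-sym; ↭⇒↭ₛ′)
open import Data.List.Relation.Binary.Permutation.Propositional.Properties using (↭-length; ∈-resp-↭)
open import Data.List.Relation.Binary.Permutation.Setoid.Properties ℤₚ.≡-setoid using (Unique-resp-↭)
open import Data.List.Relation.Binary.Subset.Propositional using (_⊆_)
open import Data.List.Relation.Binary.Subset.Propositional.Properties using (filter-⊆)
open import Data.List.Relation.Unary.All as All using (All; []; _∷_; all?)
import Data.List.Relation.Unary.All.Properties as All
open import Data.List.Relation.Unary.All.Properties using (¬Any⇒All¬; ¬All⇒Any¬)
open import Data.List.Relation.Unary.AllPairs as AllPairs using (AllPairs; []; _∷_)
import Data.List.Relation.Unary.AllPairs.Properties as AllPairs
open import Data.List.Relation.Unary.Any as Any using (Any; here; there; any?)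
open import Data.List.Relation.Unary.Linked using (Linked; [-]; _∷_)
open import Data.List.Relation.Unary.Linked.Properties using (Linked⇒AllPairs)
open import Data.List.Relation.Unary.Unique.Propositional using (Unique)
import Data.List.Relation.Unary.Unique.Propositional.Properties as Unique
open import Data.List.Relation.Unary.Unique.DecPropositional.Properties _≟_ using (deduplicate-!)
open import Data.List.Sort ℤₚ.≤-decTotalOrder using (sort; sort-↭; sort-↗)
open import Data.Empty using (⊥-elim)
open import Data.Product using (_×_; _,_; ∃-syntax; proj₂; uncurry)
open import Data.Sum using (_⊎_; inj₁; inj₂)
open import Function.Base using (_∘_; id)
open import Function.Bundles using (_⇔_; mk⇔; Equivalence)
import Function.Properties.Equivalence as ⇔
open import Relation.Binary.Definitions using (tri<; tri≈; tri>)
open import Relation.Binary.PropositionalEquality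
  using (_≡_; _≢_; ≢-sym; refl; sym; trans; cong; cong₂; subst; isEquivalence; module ≡-Reasoning)
open import Relation.Nullary using (¬_; yes; no; contradiction)
open import Relation.Unary using (Decidable; ∁)

>⇒≢ : ∀ {x y : ℤ} → y < x → x ≢ y
>⇒≢ = ≢-sym ∘ <⇒≢

Increasing : List ℤ → Set
Increasing = AllPairs _<_

module _ {x : ℤ} {xs : List ℤ} (inc : Increasing (x ∷ xs)) where

  head<tail : ∀ {y} → y ∈ xs → x < y
  head<tail = All.lookup (AllPairs.head inc)

  head≤ : ∀ {y} → y ∈ x ∷ xs → x ≤ y
  head≤ (here refl) = ℤₚ.≤-refl
  head≤ (there y∈xs) = ℤₚ.<⇒≤ (head<tail y∈xs)

  head<⇒∈tail : ∀ {y} → y ∈ x ∷ xs → x < y → y ∈ xs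
  head<⇒∈tail (here refl) x<x = ⊥-elim (ℤₚ.<-irrefl refl x<x)
  head<⇒∈tail (there y∈xs) _ = y∈xs

minimum : ∀ {ys v} → Increasing ys → v ∈ ys → ∃[ b ] (b ∈ ys × All (b ≤_) ys)
minimum {b ∷ _} inc _ = b , here refl , All.tabulate (head≤ inc)

increasing-enumeration : ∀ {xs : List ℤ} → Unique xs →
  ∃[ ys ] (Increasing ys × (∀ {x} → x ∈ ys ⇔ x ∈ xs) × length ys ≡ length xs)
increasing-enumeration {xs} xs! =
  sort xs
  , AllPairs.zipWith (uncurry ℤₚ.≤∧≢⇒<)
      (Linked⇒AllPairs ℤₚ.≤-trans (sort-↗ xs) , Unique-resp-↭ (↭⇒↭ₛ′ isEquivalence (↭-sym (sort-↭ xs))) xs!)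
  , mk⇔ (∈-resp-↭ (sort-↭ xs)) (∈-resp-↭ (↭-sym (sort-↭ xs)))
  , ↭-length (sort-↭ xs)

infix 4 _∈_+̂_

_∈_+̂_ : ℤ → List ℤ → List ℤ → Set
z ∈ xs +̂ ys = ∃[ u ] ∃[ v ] (u ∈ xs × v ∈ ys × u ≢ v × z ≡ u + v)

+̂-mono : ∀ {xs xs′ ys ys′ z} → xs ⊆ xs′ → ys ⊆ ys′ → z ∈ xs +̂ ys → z ∈ xs′ +̂ ys′
+̂-mono xs⊆ ys⊆ (u , v , u∈ , v∈ , u≢v , z≡) = u , v , xs⊆ u∈ , ys⊆ v∈ , u≢v , z≡

+̂-ordered : ∀ {xs} (Q : ℤ → Set) → (∀ {s t} → s ∈ xs → t ∈ xs → s < t → Q (s + t)) →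
            ∀ {z} → z ∈ xs +̂ xs → Q z
+̂-ordered Q ordered (u , v , u∈ , v∈ , u≢v , refl) with ℤₚ.<-cmp u v
... | tri< u<v _ _ = ordered u∈ v∈ u<v
... | tri≈ _ u≡v _ = ⊥-elim (u≢v u≡v)
... | tri> _ _ v<u = subst Q (ℤₚ.+-comm v u) (ordered v∈ u∈ v<u)

module _ {x₁ x₂ : ℤ} {xs : List ℤ} (inc : Increasing (x₁ ∷ x₂ ∷ xs)) where

  smallest-sum-≤ : ∀ {z} → z ∈ (x₁ ∷ x₂ ∷ xs) +̂ (x₁ ∷ x₂ ∷ xs) → x₁ + x₂ ≤ z
  smallest-sum-≤ = +̂-ordered (x₁ + x₂ ≤_) λ s∈ t∈ s<t →
    let x₁≤s = head≤ inc s∈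
    in ℤₚ.+-mono-≤ x₁≤s (head≤ (AllPairs.tail inc) (head<⇒∈tail inc t∈ (ℤₚ.≤-<-trans x₁≤s s<t)))

module _ {x₁ x₂ x₃ : ℤ} {xs : List ℤ} (inc : Increasing (x₁ ∷ x₂ ∷ x₃ ∷ xs)) where

  second-smallest-sum-≤ : ∀ {z} → z ∈ (x₁ ∷ x₂ ∷ x₃ ∷ xs) +̂ (x₁ ∷ x₂ ∷ x₃ ∷ xs) →
                          z ≡ x₁ + x₂ ⊎ x₁ + x₃ ≤ z
  second-smallest-sum-≤ = +̂-ordered (λ z → z ≡ x₁ + x₂ ⊎ x₁ + x₃ ≤ z) ordered
    where
    inc₂ = AllPairs.tail inc
    inc₃ = AllPairs.tail inc₂
    ordered : ∀ {s t} → s ∈ x₁ ∷ x₂ ∷ x₃ ∷ xs → t ∈ x₁ ∷ x₂ ∷ x₃ ∷ xs → s < t →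
              s + t ≡ x₁ + x₂ ⊎ x₁ + x₃ ≤ s + t
    ordered (here refl) t∈ s<t with head<⇒∈tail inc t∈ s<t
    ... | here refl = inj₁ refl
    ... | there t∈′ = inj₂ (ℤₚ.+-monoʳ-≤ x₁ (head≤ inc₃ t∈′))
    ordered (there s∈) t∈ s<t =
      inj₂ (ℤₚ.+-mono-≤ (head≤ inc (there s∈)) (head≤ inc₃ (head<⇒∈tail inc₂ t∈′ x₂<t)))
      where
      x₂<t = ℤₚ.≤-<-trans (head≤ inc₂ s∈) s<t
      t∈′ = head<⇒∈tail inc t∈ (<-trans (head<tail inc (here refl)) x₂<t)

record LargeSumset (c : ℕ) (xs ys : List ℤ) : Set where
  constructor largeSumset
  field
    sums     : List ℤ
    distinct : Unique sums
    sound    : All (_∈ xs +̂ ys) sums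
    large    : length xs ℕ.+ length ys ℕ.≤ c ℕ.+ length sums

open LargeSumset

widenˡ : ∀ {c xs ys x} → LargeSumset c xs ys → LargeSumset (suc c) (x ∷ xs) ys
widenˡ (largeSumset L L! sound large) =
  largeSumset L L! (All.map (+̂-mono there id) sound) (s≤s large)

widenʳ : ∀ {c xs ys y} → LargeSumset c xs ys → LargeSumset (suc c) xs (y ∷ ys)
widenʳ {xs = xs} {ys} (largeSumset L L! sound large) =
  largeSumset L L! (All.map (+̂-mono id there) sound)
    (ℕₚ.≤-trans (ℕₚ.≤-reflexive (ℕₚ.+-suc (length xs) (length ys))) (s≤s large))

cons-sum : ∀ {c xs ys w} (S : LargeSumset (suc c) xs ys) → w ∈ xs +̂ ys → All (w ≢_) (sums S) →
  LargeSumset c xs ys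
cons-sum {c} (largeSumset L L! sound large) w∈ w∉L =
  largeSumset (_ ∷ L) (w∉L ∷ L!) (w∈ ∷ sound)
    (ℕₚ.≤-trans large (ℕₚ.≤-reflexive (sym (ℕₚ.+-suc c (length L)))))

cons-two-smallest : ∀ {c x y z r xs ys} → Increasing (x ∷ y ∷ z ∷ r) →
  (S : LargeSumset (suc (suc c)) xs ys) → All (_∈ (y ∷ z ∷ r) +̂ (y ∷ z ∷ r)) (sums S) →
  x + y ∈ xs +̂ ys → x + z ∈ xs +̂ ys → LargeSumset c xs ys
cons-two-smallest {x = x} {y} {z} inc S S⊆ x+y∈ x+z∈ =
  cons-sum (cons-sum S x+z∈ (All.map (<⇒≢ ∘ ℤₚ.<-≤-trans x+z<y+z) y+z≤S)) x+y∈
    (<⇒≢ x+y<x+z ∷ All.map (<⇒≢ ∘ ℤₚ.<-≤-trans (<-trans x+y<x+z x+z<y+z)) y+z≤S)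
  where
  x+y<x+z = ℤₚ.+-monoʳ-< x (head<tail (AllPairs.tail inc) (here refl))
  x+z<y+z = ℤₚ.+-monoˡ-< z (head<tail inc (here refl))
  y+z≤S = All.map (smallest-sum-≤ (AllPairs.tail inc)) S⊆

module _ {x y z r} (inc : Increasing (x ∷ y ∷ z ∷ r)) where

  private
    x≢ : ∀ {w} → w ∈ y ∷ z ∷ r → x ≢ w
    x≢ = <⇒≢ ∘ head<tail inc

  cons-min-left-diagonal : ∀ {c} → LargeSumset (suc c) (y ∷ z ∷ r) (y ∷ z ∷ r) →
    LargeSumset c (x ∷ y ∷ z ∷ r) (y ∷ z ∷ r)
  cons-min-left-diagonal S = cons-two-smallest inc (widenˡ S) (sound S)
    (x , y , here refl , here refl , x≢ (here refl) , refl)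
    (x , z , here refl , there (here refl) , x≢ (there (here refl)) , refl)

  cons-min-diagonal : ∀ {c} → LargeSumset (suc c) (y ∷ z ∷ r) (y ∷ z ∷ r) →
    LargeSumset (suc c) (x ∷ y ∷ z ∷ r) (x ∷ y ∷ z ∷ r)
  cons-min-diagonal S = cons-two-smallest inc (widenˡ (widenʳ S)) (sound S)
    (x , y , here refl , there (here refl) , x≢ (here refl) , refl)
    (x , z , here refl , there (there (here refl)) , x≢ (there (here refl)) , refl)

  cons-min-both : ∀ {c ys} → ys ⊆ y ∷ z ∷ r → LargeSumset c (y ∷ z ∷ r) ys →
    LargeSumset c (x ∷ y ∷ z ∷ r) (x ∷ ys)
  cons-min-both ys⊆ S =
    cons-two-smallest inc (widenˡ (widenʳ S)) (All.map (+̂-mono id ys⊆) (sound S))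
    (y , x , there (here refl) , here refl , ≢-sym (x≢ (here refl)) , ℤₚ.+-comm x y)
    (z , x , there (there (here refl)) , here refl , ≢-sym (x≢ (there (here refl))) , ℤₚ.+-comm x z)

cons-min-left : ∀ {c x xs ys b} → Increasing (x ∷ xs) → ys ⊆ xs → b ∈ ys → All (b ≤_) ys →
  LargeSumset c xs ys → LargeSumset c (x ∷ xs) ys
cons-min-left {x = x} {b = b} inc ys⊆ b∈ b≤ys S =
  cons-sum (widenˡ S) (x , b , here refl , b∈ , <⇒≢ (head<tail inc (ys⊆ b∈)) , refl)
    (All.map x+b≢ (sound S))
  where
  x+b≢ : ∀ {w} → w ∈ _ +̂ _ → x + b ≢ w
  x+b≢ (u , v , u∈ , v∈ , _ , refl) = <⇒≢ (ℤₚ.+-mono-<-≤ (head<tail inc u∈) (All.lookup b≤ys v∈))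

sumset-large : ∀ {xs} → Increasing xs → LargeSumset 3 xs xs
sumset-large {[]} _ = largeSumset [] [] [] z≤n
sumset-large {_ ∷ []} _ = largeSumset [] [] [] (s≤s (s≤s z≤n))
sumset-large {x ∷ y ∷ []} inc =
  largeSumset [ x + y ] ([] ∷ [])
    ((x , y , here refl , there (here refl) , <⇒≢ (head<tail inc (here refl)) , refl) ∷ []) ℕₚ.≤-refl
sumset-large {_ ∷ _ ∷ _ ∷ _} inc = cons-min-diagonal inc (sumset-large (AllPairs.tail inc))

sumset-large-cons-min : ∀ {x y ys} → Increasing (x ∷ y ∷ ys) → LargeSumset 2 (x ∷ y ∷ ys) (y ∷ ys)
sumset-large-cons-min {x} {y} {[]} inc =
  largeSumset [ x + y ] ([] ∷ [])
    ((x , y , here refl , here refl , <⇒≢ (head<tail inc (here refl)) , refl) ∷ []) ℕₚ.≤-refl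
sumset-large-cons-min {ys = _ ∷ _} inc = cons-min-left-diagonal inc (sumset-large (AllPairs.tail inc))

sumset-large-singleton : ∀ {x xs} → Increasing (x ∷ xs) → LargeSumset 2 (x ∷ xs) [ x ]
sumset-large-singleton {x} {xs} inc =
  largeSumset (map (_+ x) xs)
    (Unique.map⁺ (λ {u} {v} → +-cancelʳ x u v) (AllPairs.map <⇒≢ (AllPairs.tail inc)))
    (All.map⁺ (All.tabulate λ u∈ → _ , x , there u∈ , here refl , >⇒≢ (head<tail inc u∈) , refl))
    (ℕₚ.≤-reflexive (cong suc (trans (ℕₚ.+-comm (length xs) 1) (cong suc (sym (length-map (_+ x) xs))))))

module _ {P : ℤ → Set} (P? : Decidable P) where

  -- the two Any hypotheses only rule out |xs| < 2
  cons-min-both-of-mixed : ∀ {c x xs} → Increasing (x ∷ xs) → Any P xs → Any (∁ P) xs →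
    LargeSumset c xs (filter P? xs) → LargeSumset c (x ∷ xs) (x ∷ filter P? xs)
  cons-min-both-of-mixed {xs = _ ∷ []} _ (here Py) (here ¬Py) _ = contradiction Py ¬Py
  cons-min-both-of-mixed {xs = _ ∷ []} _ (here _) (there ()) _
  cons-min-both-of-mixed {xs = _ ∷ []} _ (there ()) _ _
  cons-min-both-of-mixed {xs = _ ∷ _ ∷ _} inc _ _ = cons-min-both inc (filter-⊆ P? _)

  cons-min-left-of-filter : ∀ {c x xs} → Increasing (x ∷ xs) → Any P xs →
    LargeSumset c xs (filter P? xs) → LargeSumset c (x ∷ xs) (filter P? xs)
  cons-min-left-of-filter inc some with find some
  ... | v , v∈ , Pv with minimum (AllPairs.filter⁺ P? (AllPairs.tail inc)) (∈-filter⁺ P? v∈ Pv)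
  ...   | b , b∈ , b≤ = cons-min-left inc (filter-⊆ P? _) b∈ b≤

  sumset-large-cons-min-of-any : ∀ {x xs} → Increasing (x ∷ xs) → Any P xs → LargeSumset 2 (x ∷ xs) xs
  sumset-large-cons-min-of-any {xs = _ ∷ _} inc _ = sumset-large-cons-min inc

  sumset-large-proper : ∀ {xs} → Increasing xs → Any P xs → Any (∁ P) xs → LargeSumset 2 xs (filter P? xs)
  sumset-large-proper {x ∷ xs} inc some none with P? x
  ... | no ¬Px with all? P? xs
  ...   | yes all rewrite filter-all P? all = sumset-large-cons-min-of-any inc (Any.tail ¬Px some)
  ...   | no ¬all = cons-min-left-of-filter inc (Any.tail ¬Px some)
                      (sumset-large-proper (AllPairs.tail inc) (Any.tail ¬Px some) (¬All⇒Any¬ P? xs ¬all))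
  sumset-large-proper {x ∷ xs} inc some none | yes Px with any? P? xs
  ... | yes some′ = cons-min-both-of-mixed inc some′ none′
                      (sumset-large-proper (AllPairs.tail inc) some′ none′)
    where none′ = Any.tail (λ ¬Px → ¬Px Px) none
  ... | no none′ rewrite filter-none P? (¬Any⇒All¬ xs none′) = sumset-large-singleton inc

Progression : ℤ → List ℤ → Set
Progression δ = Linked (λ x y → y ≡ x + δ)

progression-three : ∀ {x y z} → x + z ≡ y + y → Progression (y - x) (x ∷ y ∷ z ∷ [])
progression-three {x} {y} {z} x+z≡y+y = sym x+[y-x]≡y ∷ z≡y+[y-x] ∷ [-]
  where
  open ≡-Reasoning
  x+[y-x]≡y : x + (y - x) ≡ y
  x+[y-x]≡y = trans (ℤₚ.+-comm x (y - x)) (//-rightDividesˡ x y)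
  z≡y+[y-x] : z ≡ y + (y - x)
  z≡y+[y-x] = +-cancelˡ x z (y + (y - x)) (begin
    x + z             ≡⟨ x+z≡y+y ⟩
    y + y             ≡⟨ cong (λ t → y + t) x+[y-x]≡y ⟨
    y + (x + (y - x)) ≡⟨ x∙yz≈y∙xz y x (y - x) ⟩
    x + (y + (y - x)) ∎)

progression-cons : ∀ {δ a b c d r} → a + d ≡ b + c → Progression δ (b ∷ c ∷ d ∷ r) →
  Progression δ (a ∷ b ∷ c ∷ d ∷ r)
progression-cons {δ} {a} {b} {c} {d} a+d≡b+c prog@(_ ∷ d≡c+δ ∷ _) =
  sym (+-cancelʳ c (a + δ) b a+δ+c≡b+c) ∷ prog
  where
  open ≡-Reasoning
  a+δ+c≡b+c : a + δ + c ≡ b + c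
  a+δ+c≡b+c = begin
    a + δ + c   ≡⟨ xy∙z≈x∙zy a δ c ⟩
    a + (c + δ) ≡⟨ cong (λ t → a + t) d≡c+δ ⟨
    a + d       ≡⟨ a+d≡b+c ⟩
    b + c       ∎

progression≡applyUpTo : ∀ {δ x xs} (f : ℕ → ℤ) → f 0 ≡ x → (∀ i → f (suc i) ≡ f i + δ) →
  Progression δ (x ∷ xs) → x ∷ xs ≡ applyUpTo f (suc (length xs))
progression≡applyUpTo f f0≡x _ [-] = cong [_] (sym f0≡x)
progression≡applyUpTo {δ} f f0≡x step (y≡x+δ ∷ prog) =
  cong₂ _∷_ (sym f0≡x)
    (progression≡applyUpTo (f ∘ suc) (trans (step 0) (trans (cong (_+ δ) f0≡x) (sym y≡x+δ)))
      (step ∘ suc) prog)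

∈-progression : ∀ {δ τ xs y} → Progression δ (τ ∷ xs) →
  y ∈ τ ∷ xs ⇔ (∃[ i ] (i ℕ.< length (τ ∷ xs) × y ≡ τ + + i * δ))
∈-progression {δ} {τ} {xs} {y} prog =
  mk⇔ (λ y∈ → ∈-applyUpTo⁻ f (subst (y ∈_) τ∷xs≡ y∈))
      (λ { (i , i< , refl) → subst (f i ∈_) (sym τ∷xs≡) (∈-applyUpTo⁺ f i<) })
  where
  open ≡-Reasoning
  f : ℕ → ℤ
  f i = τ + + i * δ
  τ∷xs≡ : τ ∷ xs ≡ applyUpTo f (suc (length xs))
  τ∷xs≡ = progression≡applyUpTo f (ℤₚ.+-identityʳ τ) (λ i → begin
    τ + + suc i * δ   ≡⟨ cong (λ t → τ + t) (ℤₚ.suc-* (+ i) δ) ⟩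
    τ + (δ + + i * δ) ≡⟨ x∙yz≈xz∙y τ δ (+ i * δ) ⟩
    τ + + i * δ + δ   ∎) prog

sumset-large-of-gap : ∀ {a b c d r} → Increasing (a ∷ b ∷ c ∷ d ∷ r) → a + d ≢ b + c →
  LargeSumset 2 (a ∷ b ∷ c ∷ d ∷ r) (a ∷ b ∷ c ∷ d ∷ r)
sumset-large-of-gap {a} {b} {c} {d} inc a+d≢b+c =
  cons-sum (sumset-large inc) (a , d , here refl , there (there (there (here refl))) , <⇒≢ a<d , refl)
    (>⇒≢ a+b<a+d ∷ >⇒≢ a+c<a+d ∷ All.map a+d≢ (sound (sumset-large inc₂)))
  where
  inc₂ = AllPairs.tail inc
  a<d = head<tail inc (there (there (here refl)))
  a+c<a+d = ℤₚ.+-monoʳ-< a (head<tail (AllPairs.tail inc₂) (here refl))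
  a+b<a+d = <-trans (ℤₚ.+-monoʳ-< a (head<tail inc₂ (here refl))) a+c<a+d
  a+d≢ : ∀ {z} → z ∈ (b ∷ c ∷ d ∷ _) +̂ (b ∷ c ∷ d ∷ _) → a + d ≢ z
  a+d≢ z∈ with second-smallest-sum-≤ inc₂ z∈
  ... | inj₁ refl = a+d≢b+c
  ... | inj₂ b+d≤z = <⇒≢ (ℤₚ.<-≤-trans (ℤₚ.+-monoˡ-< d (head<tail inc (here refl))) b+d≤z)

module _ {a b c d e} (inc : Increasing (a ∷ b ∷ c ∷ d ∷ e ∷ [])) where

  private
    a<b = head<tail inc (here refl)
    b<c = head<tail (AllPairs.tail inc) (here refl)
    c<d = head<tail (AllPairs.tail (AllPairs.tail inc)) (here refl)
    d<e = head<tail (AllPairs.tail (AllPairs.tail (AllPairs.tail inc))) (here refl)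
    b<e = <-trans b<c (<-trans c<d d<e)
    ab<ac = ℤₚ.+-monoʳ-< a b<c
    ac<ad = ℤₚ.+-monoʳ-< a c<d
    ad<ae = ℤₚ.+-monoʳ-< a d<e
    ac<bc = ℤₚ.+-monoˡ-< c a<b
    ae<be = ℤₚ.+-monoˡ-< e a<b
    bc<bd = ℤₚ.+-monoʳ-< b c<d
    bd<be = ℤₚ.+-monoʳ-< b d<e
    be<ce = ℤₚ.+-monoˡ-< e b<c
    ce<de = ℤₚ.+-monoˡ-< e c<d

    -- definitionally, the sums listed by sumset-large inc
    chain : List ℤ
    chain = a + b ∷ a + c ∷ b + c ∷ b + d ∷ c + d ∷ c + e ∷ d + e ∷ []

    e∈ : e ∈ a ∷ b ∷ c ∷ d ∷ e ∷ []
    e∈ = there (there (there (there (here refl))))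

  five-progression-or-large : a + d ≡ b + c →
    (∃[ δ ] Progression δ (a ∷ b ∷ c ∷ d ∷ e ∷ [])) ⊎
    LargeSumset 2 (a ∷ b ∷ c ∷ d ∷ e ∷ []) (a ∷ b ∷ c ∷ d ∷ e ∷ [])
  five-progression-or-large a+d≡b+c with b + e ≟ c + d | a + e ≟ b + d
  ... | no b+e≢c+d | _ =
    inj₂ (cons-sum (sumset-large inc) (b , e , there (here refl) , e∈ , <⇒≢ b<e , refl) b+e∉)
    where
    b+e∉ : All (b + e ≢_) chain
    b+e∉ = >⇒≢ (<-trans ab<ac (<-trans ac<bc (<-trans bc<bd bd<be)))
         ∷ >⇒≢ (<-trans ac<bc (<-trans bc<bd bd<be)) ∷ >⇒≢ (<-trans bc<bd bd<be) ∷ >⇒≢ bd<be ∷ b+e≢c+d ∷ <⇒≢ be<ce ∷ <⇒≢ (<-trans be<ce ce<de) ∷ []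
  ... | yes b+e≡c+d | no a+e≢b+d =
    inj₂ (cons-sum (sumset-large inc) (a , e , here refl , e∈ , <⇒≢ (<-trans a<b b<e) , refl) a+e∉)
    where
    a+e∉ : All (a + e ≢_) chain
    a+e∉ = >⇒≢ (<-trans ab<ac (<-trans ac<ad ad<ae)) ∷ >⇒≢ (<-trans ac<ad ad<ae)
         ∷ >⇒≢ (subst (_< a + e) a+d≡b+c ad<ae) ∷ a+e≢b+d ∷ <⇒≢ (subst (a + e <_) b+e≡c+d ae<be)
         ∷ <⇒≢ (<-trans ae<be be<ce) ∷ <⇒≢ (<-trans ae<be (<-trans be<ce ce<de)) ∷ []
  ... | yes b+e≡c+d | yes a+e≡b+d =
    inj₁ (d - c , progression-cons a+d≡b+c (progression-cons b+e≡c+d (progression-three c+e≡d+d)))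
    where
    open ≡-Reasoning
    c+e≡d+d : c + e ≡ d + d
    c+e≡d+d = +-cancelʳ a (c + e) (d + d) (begin
      c + e + a   ≡⟨ xy∙z≈x∙zy c e a ⟩
      c + (a + e) ≡⟨ cong (λ t → c + t) a+e≡b+d ⟩
      c + (b + d) ≡⟨ x∙yz≈yx∙z c b d ⟩
      b + c + d   ≡⟨ cong (_+ d) a+d≡b+c ⟨
      a + d + d   ≡⟨ xy∙z≈yz∙x a d d ⟩
      d + d + a   ∎)

progression-or-large : ∀ {xs} → Increasing xs → 5 ℕ.≤ length xs →
  (∃[ δ ] Progression δ xs) ⊎ LargeSumset 2 xs xs
progression-or-large {[]} _ ()
progression-or-large {_ ∷ []} _ (s≤s ())
progression-or-large {_ ∷ _ ∷ []} _ (s≤s (s≤s ()))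
progression-or-large {_ ∷ _ ∷ _ ∷ []} _ (s≤s (s≤s (s≤s ())))
progression-or-large {_ ∷ _ ∷ _ ∷ _ ∷ []} _ (s≤s (s≤s (s≤s (s≤s ()))))
progression-or-large {a ∷ b ∷ c ∷ d ∷ _ ∷ []} inc _ with a + d ≟ b + c
... | no a+d≢b+c = inj₂ (sumset-large-of-gap inc a+d≢b+c)
... | yes a+d≡b+c = five-progression-or-large inc a+d≡b+c
progression-or-large {a ∷ b ∷ c ∷ d ∷ _ ∷ _ ∷ _} inc _
  with a + d ≟ b + c | progression-or-large (AllPairs.tail inc) (s≤s (s≤s (s≤s (s≤s (s≤s z≤n)))))
... | no a+d≢b+c | _ = inj₂ (sumset-large-of-gap inc a+d≢b+c)
... | yes a+d≡b+c | inj₁ (δ , prog) = inj₁ (δ , progression-cons a+d≡b+c prog)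
... | yes _ | inj₂ large = inj₂ (cons-min-diagonal inc large)

isAP-of-progression : ∀ {A : FinSetℤ} {xs δ} → Increasing xs → 1 ℕ.< length xs →
  (∀ {x} → x ∈ xs ⇔ x ∈ₛ A) → length xs ≡ ∣ A ∣ₛ → Progression δ xs →
  ∃[ τ ] ∃[ d ] (d ≢ 0ℤ × IsAPWith A τ d ∣ A ∣ₛ)
isAP-of-progression {xs = _ ∷ []} _ (s≤s ()) _ _ _
isAP-of-progression {A} {τ ∷ _ ∷ _} {δ} inc _ xs≈A |xs|≡|A| prog@(y≡τ+δ ∷ _) =
  τ , δ , δ≢0 , subst (IsAPWith A τ δ) |xs|≡|A| (λ x → ⇔.trans (⇔.sym xs≈A) (∈-progression prog))
  where
  δ≢0 : δ ≢ 0ℤ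
  δ≢0 refl = <⇒≢ (head<tail inc (here refl)) (sym (trans y≡τ+δ (ℤₚ.+-identityʳ τ)))

length-unique-set : ∀ {xs ys : List ℤ} → Unique xs → Unique ys → (∀ {x} → x ∈ xs ⇔ x ∈ ys) →
  length xs ≡ length ys
length-unique-set xs! ys! xs≈ys = ↭-length (∼bag⇒↭ (unique∧set⇒bag xs! ys! xs≈ys))

unique-⊆⇒length-≤ : ∀ {xs ys : List ℤ} → Unique xs → xs ⊆ ys → length xs ℕ.≤ length ys
unique-⊆⇒length-≤ {xs} {ys} xs! xs⊆ys = begin
  length xs                      ≡⟨ length-unique-set xs! (Unique.filter⁺ (_∈? xs) (deduplicate-! ys)) xs≈ ⟩
  length (filter (_∈? xs) dedup) ≤⟨ length-filter (_∈? xs) dedup ⟩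
  length dedup                   ≤⟨ length-deduplicate _≟_ ys ⟩
  length ys                      ∎
  where
  open ℕₚ.≤-Reasoning
  dedup = deduplicate _≟_ ys
  xs≈ : ∀ {x} → x ∈ xs ⇔ x ∈ filter (_∈? xs) dedup
  xs≈ = mk⇔ (λ x∈ → ∈-filter⁺ (_∈? xs) (∈-deduplicate⁺ _≟_ (xs⊆ys x∈)) x∈)
            (λ x∈ → proj₂ (∈-filter⁻ (_∈? xs) {xs = dedup} x∈))

nonempty⊆⇒Any : ∀ {xs ys : List ℤ} → 0 ℕ.< length ys → (∀ {y} → y ∈ ys → y ∈ xs) → Any (_∈ ys) xs
nonempty⊆⇒Any {ys = _ ∷ _} _ ys⊆xs = lose (ys⊆xs (here refl)) (here refl)

restricted-sumset-size-≥ : ∀ {A B S c xs ys} → IsRestrictedSumset A B S →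
  (∀ {x} → x ∈ xs → x ∈ₛ A) → (∀ {y} → y ∈ ys → y ∈ₛ B) →
  LargeSumset c xs ys → length xs ℕ.+ length ys ℕ.≤ c ℕ.+ ∣ S ∣ₛ
restricted-sumset-size-≥ {S = S} {c} {xs} {ys} S≐A+̂B xs⊆A ys⊆B (largeSumset L L! sound large) =
  ℕₚ.≤-trans large (ℕₚ.+-monoʳ-≤ c (unique-⊆⇒length-≤ L! (L⊆S ∘ All.lookup sound)))
  where
  L⊆S : ∀ {z} → z ∈ xs +̂ ys → z ∈ₛ S
  L⊆S {z} (u , v , u∈ , v∈ , u≢v , z≡u+v) =
    Equivalence.from (S≐A+̂B z) (u , v , xs⊆A u∈ , ys⊆B v∈ , u≢v , z≡u+v)

module CriticalPair {A B S : FinSetℤ} (B⊆A : B ⊆ₛ A) (S≐A+̂B : IsRestrictedSumset A B S)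
  (|S|+3≡|A|+|B| : ∣ S ∣ₛ ℕ.+ 3 ≡ ∣ A ∣ₛ ℕ.+ ∣ B ∣ₛ)
  {xs : List ℤ} (inc : Increasing xs) (xs≈A : ∀ {x} → x ∈ xs ⇔ x ∈ₛ A) (|xs|≡|A| : length xs ≡ ∣ A ∣ₛ)
  where

  private
    not-large : ∀ {ys} → (∀ {y} → y ∈ ys → y ∈ₛ B) → length ys ≡ ∣ B ∣ₛ → ¬ LargeSumset 2 xs ys
    not-large {ys} ys⊆B |ys|≡|B| large = ℕₚ.<-irrefl refl (begin-strict
      2 ℕ.+ ∣ S ∣ₛ              ≡⟨ ℕₚ.+-comm 2 ∣ S ∣ₛ ⟩
      ∣ S ∣ₛ ℕ.+ 2              <⟨ ℕₚ.+-monoʳ-< ∣ S ∣ₛ (ℕₚ.n<1+n 2) ⟩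
      ∣ S ∣ₛ ℕ.+ 3              ≡⟨ |S|+3≡|A|+|B| ⟩
      ∣ A ∣ₛ ℕ.+ ∣ B ∣ₛ          ≡⟨ cong₂ ℕ._+_ |xs|≡|A| |ys|≡|B| ⟨
      length xs ℕ.+ length ys ≤⟨ restricted-sumset-size-≥ {A} {B} {S} S≐A+̂B (Equivalence.to xs≈A) ys⊆B large ⟩
      2 ℕ.+ ∣ S ∣ₛ              ∎)
      where open ℕₚ.≤-Reasoning

    P? : Decidable (_∈ₛ B)
    P? x = x ∈? elems B

    B∩xs⊆B : ∀ {y} → y ∈ filter P? xs → y ∈ₛ B
    B∩xs⊆B = proj₂ ∘ ∈-filter⁻ P? {xs = xs}

    |B∩xs|≡|B| : length (filter P? xs) ≡ ∣ B ∣ₛ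
    |B∩xs|≡|B| = length-unique-set (Unique.filter⁺ P? {xs} (AllPairs.map <⇒≢ inc)) (unique B)
      (mk⇔ B∩xs⊆B (λ x∈B → ∈-filter⁺ P? (Equivalence.from xs≈A (B⊆A x∈B)) x∈B))

  xs⊆B : 0 ℕ.< ∣ B ∣ₛ → All (_∈ₛ B) xs
  xs⊆B |B|>0 with all? P? xs
  ... | yes xs⊆B = xs⊆B
  ... | no xs⊈B = ⊥-elim (not-large B∩xs⊆B |B∩xs|≡|B| (sumset-large-proper P? inc
          (nonempty⊆⇒Any |B|>0 (Equivalence.from xs≈A ∘ B⊆A)) (¬All⇒Any¬ P? xs xs⊈B)))

  A≐B : 0 ℕ.< ∣ B ∣ₛ → A ≐ₛ B
  A≐B |B|>0 x = mk⇔ (All.lookup (xs⊆B |B|>0) ∘ Equivalence.from xs≈A) B⊆A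

  progression : 5 ℕ.≤ length xs → All (_∈ₛ B) xs → ∃[ δ ] Progression δ xs
  progression |xs|≥5 xs⊆B with progression-or-large inc |xs|≥5
  ... | inj₁ prog = prog
  ... | inj₂ large =
    ⊥-elim (not-large (All.lookup xs⊆B) (trans (cong length (sym (filter-all P? xs⊆B))) |B∩xs|≡|B|) large)

lemma4 : (A B : FinSetℤ) →
    ∣ A ∣ₛ ℕ.≥ 5 → ∣ B ∣ₛ ℕ.≥ 2 → B ⊆ₛ A →
    (S : FinSetℤ) → IsRestrictedSumset A B S →
    ∣ S ∣ₛ ℕ.+ 3 ≡ ∣ A ∣ₛ ℕ.+ ∣ B ∣ₛ →
    (A ≐ₛ B) × (∃[ τ ] ∃[ d ] (d ≢ 0ℤ × IsAPWith A τ d ∣ A ∣ₛ))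
lemma4 A B |A|≥5 |B|≥2 B⊆A S S≐A+̂B |S|+3≡|A|+|B| with increasing-enumeration (unique A)
... | xs , inc , xs≈A , |xs|≡|A| =
  A≐B |B|>0 ,
  isAP-of-progression {A} inc (ℕₚ.≤-trans (s≤s (s≤s z≤n)) |xs|≥5) xs≈A |xs|≡|A|
    (proj₂ (progression |xs|≥5 (xs⊆B |B|>0)))
  where
  open CriticalPair {A} {B} {S} B⊆A S≐A+̂B |S|+3≡|A|+|B| inc xs≈A |xs|≡|A|
  |xs|≥5 : 5 ℕ.≤ length xs
  |xs|≥5 = subst (5 ℕ.≤_) (sym |xs|≡|A|) |A|≥5
  |B|>0 : 0 ℕ.< ∣ B ∣ₛ
  |B|>0 = ℕₚ.≤-trans (s≤s z≤n) |B|≥2
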